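{- Let $m$ and $s$ be even integers with $m\geq 2$, $s\geq 6$ and $s\equiv 2\pmod 4$. Let $t$ be a divisor of $2ms$ and set $\ell=\frac{2ms}{t}+1$. There exists a sequence $\mathcal{B}'$ of $\frac{m}{2}$ shiftable blocks of size $2\times s$ such that $\mathcal{B}'$ satisfies Condition (D) and $\operatorname{supp}(\mathcal{B}')=[1,ms+\lfloor t/2\rfloor]\setminus\{j\ell: j\in[1,\lfloor t/2\rfloor]\}$.
   Context: For integers $a\leq b$, $[a,b]=\{a,a+1,\ldots,b\}$. A block is a (fully filled) array with integer entries; it is shiftable if every row and every column contains an equal number of positive and negative entries. For a sequence $\mathcal{B}$ of blocks, $\operatorname{supp}(\mathcal{B})$ is the set of absolute values of all entries of all blocks in $\mathcal{B}$. A sequence $\mathcal{B}$ of blocks satisfies Condition (D) if there exist integers $\sigma_1,\ldots,\sigma_{2b}$ (the same for all blocks of the sequence) with $\sum_{i=1}^b\sigma_{2i-1}=\sum_{i=1}^b\sigma_{2i}=0$ such that every element $B$ of $\mathcal{B}$ is a shiftable block of size $2\times 2b$ whose two rows each sum to $0$ and whose $i$-th column sums to $\sigma_i$ for all $i\in[1,2b]$. -}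

module Defs where

open import Data.Nat as ℕ using (ℕ; zero; suc; _≡ᵇ_; _%_)
open import Data.Integer as ℤ using (ℤ; +_; _+_; ∣_∣)
open import Data.Fin using (Fin; toℕ)
open import Data.List using (length; filter)
open import Data.List using (allFin) public
open import Data.Bool using (if_then_else_)
open import Data.Product using (Σ; _×_; ∃)
open import Function using (_∘_)
open import Relation.Binary.PropositionalEquality using (_≡_)

Block : ℕ → Set
Block n = Fin 2 → Fin n → ℤ

sumℤ : ∀ {n} → (Fin n → ℤ) → ℤ
sumℤ {zero} _ = + 0
sumℤ {suc n} v = v Fin.zero + sumℤ (v ∘ Fin.suc)
  where import Data.Fin as Fin

#pos : ∀ {n} → (Fin n → ℤ) → ℕ
#pos {n} v = length (filter (λ j → + 0 ℤ.<? v j) (allFin n))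

#neg : ∀ {n} → (Fin n → ℤ) → ℕ
#neg {n} v = length (filter (λ j → v j ℤ.<? + 0) (allFin n))

Shiftable : ∀ {n} → Block n → Set
Shiftable {n} B =
  (∀ (r : Fin 2) → #pos (B r) ≡ #neg (B r)) ×
  (∀ (c : Fin n) → #pos (λ r → B r c) ≡ #neg (λ r → B r c))

-- Condition (D) for a sequence of k blocks of size 2 × n (n = 2b).
-- Columns are 0-indexed here: paper's σ_{2i-1} are the entries with even
-- 0-based index, σ_{2i} those with odd 0-based index.
ConditionD : ∀ {k n} → (Fin k → Block n) → Set
ConditionD {k} {n} 𝓑 =
  ∃ λ (σ : Fin n → ℤ) →
    (sumℤ (λ i → if toℕ i % 2 ≡ᵇ 0 then σ i else + 0) ≡ + 0) ×
    (sumℤ (λ i → if toℕ i % 2 ≡ᵇ 1 then σ i else + 0) ≡ + 0) ×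
    (∀ (q : Fin k) →
       Shiftable (𝓑 q) ×
       (∀ (r : Fin 2) → sumℤ (𝓑 q r) ≡ + 0) ×
       (∀ (c : Fin n) → sumℤ (λ r → 𝓑 q r c) ≡ σ c))

InSupp : ∀ {k n} → (Fin k → Block n) → ℕ → Set
InSupp {k} {n} 𝓑 x = Σ (Fin k) λ q → Σ (Fin 2) λ r → Σ (Fin n) λ c → ∣ 𝓑 q r c ∣ ≡ x

-- Write m = 2n, s = 6 + 4k and D = s/2 = 3 + 2k. A block is read off a table of D quadruples
-- {y, y + a, y + b, y + a + b}: quadruples 0, 1, 2, whose first elements lie w₁ and w₂ apart, fill a fixed
-- 2 × 6 box, and the remaining quadruples fill 2 × 4 patterns two at a time. Every row of these patterns
-- sums to 0 and every column sum depends only on a, b, w₁ and w₂, so blocks built from tables with the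
-- same offsets share their column sums σ, whose even and odd parts vanish.
-- The required support is laid out as a grid whose row A holds Aℓ + 1, …, Aℓ + ℓ − 1; for odd t each
-- such row is split into two rows of length M = (ℓ − 1)/2, and a last half row is added. The grid has
-- 4nD cells; it is cut into 1 × 4, 4 × 1 or 2 × 2 tiles, one quadruple each, and the tiles are grouped
-- into n rectangles of g × h tiles with gh = D, one rectangle per block. When h = 1 the quadruples
-- 0, 1, 2 of a block lie in consecutive rows, which for odd t start alternately M and M + 1 apart; the
-- two skew boxes absorb exactly this.

module Submission where

open import Defs
open import Data.Bool using (Bool; true; false; if_then_else_)
open import Data.Empty using (⊥-elim)
open import Data.Fin as Fin using (Fin; toℕ)
open import Data.Fin.Properties using (all?; any?; toℕ-fromℕ<; toℕ<n)
open import Data.Integer as ℤ using (ℤ; +_; -[1+_]; ∣_∣)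
import Data.Integer.Properties as ℤ
open import Data.Integer.Tactic.RingSolver using (solve-∀)
open import Data.List using ([]; _∷_; length; filter; map; tabulate)
open import Data.List.Properties using (map-tabulate)
open import Data.Nat as ℕ using (ℕ; zero; suc; _+_; _*_; _∸_; _^_; _≤_; _<_; _%_; _/_; _≡ᵇ_; s≤s; z≤n)
import Data.Nat.Properties as ℕ
open import Data.Nat.Coprimality using (Coprime; coprime-/gcd; coprime-divisor)
open import Data.Nat.Divisibility using (_∣_; divides; n∣m*n)
open _∣_ using (quotient)
open import Data.Nat.DivMod
  using (m≡m%n+[m/n]*n; m%n<n; m<n*o⇒m/o<n; m*n/n≡m; m*n%n≡0; m<n⇒m/n≡0; m<n⇒m%n≡m; +-distrib-/-∣ˡ; %-remove-+ˡ)
open import Data.Nat.GCD using (gcd; gcd[m,n]∣m; gcd[m,n]∣n; gcd[m,n]≡0⇒m≡0)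
import Data.Nat.Tactic.RingSolver as ℕ-Solver
open import Algebra.Properties.CommutativeSemigroup ℕ.+-commutativeSemigroup using (xy∙z≈xz∙y)
open import Data.Product using (Σ; _×_; ∃; _,_; proj₁; proj₂; uncurry)
open import Data.Product.Properties using (≡-dec)
open import Function using (_∘_; id)
open import Function.Bundles using (_⇔_; mk⇔)
open import Function.Properties.Equivalence using () renaming (refl to ⇔-refl; trans to ⇔-trans)
open import Relation.Binary.PropositionalEquality using (_≡_; _≢_; refl; sym; trans; cong; cong₂; subst; subst₂)
open import Relation.Nullary using (¬_; Dec; yes; no; does)
open import Relation.Nullary.Decidable using (toWitness; _×-dec_)
open import Relation.Unary using (Pred; Decidable)

sumUpTo : ℕ → (ℕ → ℤ) → ℤ
sumUpTo zero    f = + 0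
sumUpTo (suc n) f = f 0 ℤ.+ sumUpTo n (f ∘ suc)

countUpTo : ℕ → (ℕ → Bool) → ℕ
countUpTo zero    p = 0
countUpTo (suc n) p = (if p 0 then 1 else 0) + countUpTo n (p ∘ suc)

sumUpTo-+ : ∀ m n f → sumUpTo (m + n) f ≡ sumUpTo m f ℤ.+ sumUpTo n (λ c → f (m + c))
sumUpTo-+ zero    n f = sym (ℤ.+-identityˡ _)
sumUpTo-+ (suc m) n f = trans (cong (ℤ._+_ (f 0)) (sumUpTo-+ m n (f ∘ suc))) (sym (ℤ.+-assoc (f 0) _ _))

countUpTo-+ : ∀ m n p → countUpTo (m + n) p ≡ countUpTo m p + countUpTo n (λ c → p (m + c))
countUpTo-+ zero    n p = refl
countUpTo-+ (suc m) n p = trans (cong (_+_ (if p 0 then 1 else 0)) (countUpTo-+ m n (p ∘ suc)))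
                                (sym (ℕ.+-assoc (if p 0 then 1 else 0) _ _))

sumUpTo-cong : ∀ n {f g : ℕ → ℤ} → (∀ c → c < n → f c ≡ g c) → sumUpTo n f ≡ sumUpTo n g
sumUpTo-cong zero    eq = refl
sumUpTo-cong (suc n) eq = cong₂ ℤ._+_ (eq 0 (s≤s z≤n)) (sumUpTo-cong n (λ c c<n → eq (suc c) (s≤s c<n)))

sumℤ-toℕ : ∀ n (f : ℕ → ℤ) → sumℤ {n} (f ∘ toℕ) ≡ sumUpTo n f
sumℤ-toℕ zero    f = refl
sumℤ-toℕ (suc n) f = cong (ℤ._+_ (f 0)) (sumℤ-toℕ n (f ∘ suc))

length-filter-map : ∀ {a b p} {A : Set a} {B : Set b} {P : Pred B p} (P? : Decidable P) (f : A → B) xs →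
  length (filter P? (map f xs)) ≡ length (filter (P? ∘ f) xs)
length-filter-map P? f []       = refl
length-filter-map P? f (x ∷ xs) with does (P? (f x))
... | true  = cong suc (length-filter-map P? f xs)
... | false = length-filter-map P? f xs

length-filter-tabulate-suc : ∀ {p} {n} {P : Pred (Fin (suc n)) p} (P? : Decidable P) →
  length (filter P? (tabulate Fin.suc)) ≡ length (filter (P? ∘ Fin.suc) (allFin n))
length-filter-tabulate-suc {n = n} P? =
  trans (cong (length ∘ filter P?) (sym (map-tabulate id Fin.suc))) (length-filter-map P? Fin.suc (allFin n))

length-filter-allFin-suc : ∀ {p} {n} {P : Pred (Fin (suc n)) p} (P? : Decidable P) →
  length (filter P? (allFin (suc n))) ≡ (if does (P? Fin.zero) then 1 else 0) + length (filter (P? ∘ Fin.suc) (allFin n))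
length-filter-allFin-suc P? with does (P? Fin.zero)
... | true  = cong suc (length-filter-tabulate-suc P?)
... | false = length-filter-tabulate-suc P?

length-filter-allFin : ∀ {p} {P : Pred ℤ p} (P? : Decidable P) n (f : ℕ → ℤ) →
  length (filter (P? ∘ f ∘ toℕ) (allFin n)) ≡ countUpTo n (λ c → does (P? (f c)))
length-filter-allFin P? zero    f = refl
length-filter-allFin P? (suc n) f =
  trans (length-filter-allFin-suc (P? ∘ f ∘ toℕ)) (cong (_+_ _) (length-filter-allFin P? n (f ∘ suc)))

positive negative : ℤ → Bool
positive x = does (+ 0 ℤ.<? x)
negative x = does (x ℤ.<? + 0)

data Column (A : Set) : Set where
  ⁺⁻ ⁻⁺ : A → A → Column A

mapColumn : ∀ {A B : Set} → (A → B) → Column A → Column B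
mapColumn f (⁺⁻ x y) = ⁺⁻ (f x) (f y)
mapColumn f (⁻⁺ x y) = ⁻⁺ (f x) (f y)

value : ∀ {A : Set} → Fin 2 → Column A → A
value Fin.zero       (⁺⁻ x _) = x
value (Fin.suc _)    (⁺⁻ _ y) = y
value Fin.zero       (⁻⁺ x _) = x
value (Fin.suc _)    (⁻⁺ _ y) = y

entry : Fin 2 → Column ℕ → ℤ
entry Fin.zero       (⁺⁻ x _) = + suc x
entry (Fin.suc _)    (⁺⁻ _ y) = -[1+ y ]
entry Fin.zero       (⁻⁺ x _) = -[1+ x ]
entry (Fin.suc _)    (⁻⁺ _ y) = + suc y

∣entry∣≡suc-value : ∀ r col → ∣ entry r col ∣ ≡ suc (value r col)
∣entry∣≡suc-value Fin.zero    (⁺⁻ _ _) = refl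
∣entry∣≡suc-value (Fin.suc _) (⁺⁻ _ _) = refl
∣entry∣≡suc-value Fin.zero    (⁻⁺ _ _) = refl
∣entry∣≡suc-value (Fin.suc _) (⁻⁺ _ _) = refl

value-mapColumn : ∀ {A B : Set} (f : A → B) r col → value r (mapColumn f col) ≡ f (value r col)
value-mapColumn f Fin.zero    (⁺⁻ _ _) = refl
value-mapColumn f (Fin.suc _) (⁺⁻ _ _) = refl
value-mapColumn f Fin.zero    (⁻⁺ _ _) = refl
value-mapColumn f (Fin.suc _) (⁻⁺ _ _) = refl

columnSum : Column ℕ → ℤ
columnSum col = sumℤ (λ r → entry r col)

column-shiftable : ∀ col → #pos (λ r → entry r col) ≡ #neg (λ r → entry r col)
column-shiftable (⁺⁻ _ _) = refl
column-shiftable (⁻⁺ _ _) = refl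

Cell : Set
Cell = ℕ × ℕ

-- V u e + 1 is the absolute value of element e < 4 of quadruple u; a cell (u , e) addresses it.
Table : Set
Table = ℕ → ℕ → ℕ

fill : Table → Column Cell → Column ℕ
fill V = mapColumn (uncurry V)

∣entry-fill∣ : ∀ V r col → ∣ entry r (fill V col) ∣ ≡ suc (uncurry V (value r col))
∣entry-fill∣ V r col = trans (∣entry∣≡suc-value r (fill V col)) (cong suc (value-mapColumn (uncurry V) r col))

fill-cong : ∀ {V W} col → (∀ r → uncurry V (value r col) ≡ uncurry W (value r col)) → fill V col ≡ fill W col
fill-cong (⁺⁻ _ _) eq = cong₂ ⁺⁻ (eq Fin.zero) (eq (Fin.suc Fin.zero))
fill-cong (⁻⁺ _ _) eq = cong₂ ⁻⁺ (eq Fin.zero) (eq (Fin.suc Fin.zero))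

InRange : ℕ → Cell → Set
InRange D (u , e) = u < D × e < 4

inRange? : ∀ D cell → Dec (InRange D cell)
inRange? D (u , e) = (u ℕ.<? D) ×-dec (e ℕ.<? 4)

-- Quadruples and the columns built from pairs of them

record Quadruple (a b : ℕ) (v : ℕ → ℕ) : Set where
  field
    second : v 1 ≡ v 0 + a
    third  : v 2 ≡ v 0 + b
    fourth : v 3 ≡ v 0 + a + b

Quadruples : ℕ → ℕ → Table → Set
Quadruples a b V = ∀ u → Quadruple a b (V u)

quadrupleFrom : (y a b : ℕ) → ℕ → ℕ
quadrupleFrom y a b 0 = y
quadrupleFrom y a b 1 = y + a
quadrupleFrom y a b 2 = y + b
quadrupleFrom y a b _ = y + a + b

quadruple-values : ∀ {a b v} → Quadruple a b v → ∀ e → e < 4 → v e ≡ quadrupleFrom (v 0) a b e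
quadruple-values q 0 _ = refl
quadruple-values q 1 _ = Quadruple.second q
quadruple-values q 2 _ = Quadruple.third q
quadruple-values q 3 _ = Quadruple.fourth q
quadruple-values q (suc (suc (suc (suc _)))) (s≤s (s≤s (s≤s (s≤s ()))))

pairCells : ℕ → ℕ → Column Cell
pairCells u 0 = ⁺⁻ (u , 1) (u , 0)
pairCells u 1 = ⁻⁺ (u , 2) (u , 3)
pairCells u 2 = ⁻⁺ (suc u , 1) (suc u , 0)
pairCells u 3 = ⁺⁻ (suc u , 2) (suc u , 3)
pairCells u (suc (suc (suc (suc c)))) = pairCells (2 + u) c

pairSums : ℕ → ℕ → ℤ
pairSums a 0 = + a
pairSums a 1 = + a
pairSums a 2 = ℤ.- + a
pairSums a 3 = ℤ.- + a
pairSums a (suc (suc (suc (suc c)))) = pairSums a c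

pair-rowSum-canonical : ∀ y z a b r T →
  entry r (⁺⁻ (y + a) y) ℤ.+ (entry r (⁻⁺ (y + b) (y + a + b)) ℤ.+
    (entry r (⁻⁺ (z + a) z) ℤ.+ (entry r (⁺⁻ (z + b) (z + a + b)) ℤ.+ T))) ≡ T
pair-rowSum-canonical y z a b Fin.zero T = top (+ suc y) (+ suc z) (+ a) (+ b) T
  where
  top : ∀ Y Z A B T → (Y ℤ.+ A) ℤ.+ (ℤ.- (Y ℤ.+ B) ℤ.+ (ℤ.- (Z ℤ.+ A) ℤ.+ ((Z ℤ.+ B) ℤ.+ T))) ≡ T
  top = solve-∀
pair-rowSum-canonical y z a b (Fin.suc Fin.zero) T = bottom (+ suc y) (+ suc z) (+ a) (+ b) T
  where
  bottom : ∀ Y Z A B T → ℤ.- Y ℤ.+ ((Y ℤ.+ A ℤ.+ B) ℤ.+ (Z ℤ.+ (ℤ.- (Z ℤ.+ A ℤ.+ B) ℤ.+ T))) ≡ T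
  bottom = solve-∀

pair-rowSum : ∀ {a b} {v w : ℕ → ℕ} → Quadruple a b v → Quadruple a b w → ∀ r T →
  entry r (⁺⁻ (v 1) (v 0)) ℤ.+ (entry r (⁻⁺ (v 2) (v 3)) ℤ.+
    (entry r (⁻⁺ (w 1) (w 0)) ℤ.+ (entry r (⁺⁻ (w 2) (w 3)) ℤ.+ T))) ≡ T
pair-rowSum {a} {b} {v} {w} qv qw r T
  rewrite Quadruple.second qv | Quadruple.third qv | Quadruple.fourth qv
        | Quadruple.second qw | Quadruple.third qw | Quadruple.fourth qw
  = pair-rowSum-canonical (v 0) (w 0) a b r T

pairCells-rowSum : ∀ {a b V} → Quadruples a b V → ∀ k u r →
  sumUpTo (k * 4) (λ c → entry r (fill V (pairCells u c))) ≡ + 0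
pairCells-rowSum q zero    u r = refl
pairCells-rowSum q (suc k) u r = trans (pair-rowSum (q u) (q (suc u)) r _) (pairCells-rowSum q k (2 + u) r)

pairCells-columnSum : ∀ {a b V} → Quadruples a b V → ∀ u c → columnSum (fill V (pairCells u c)) ≡ pairSums a c
pairCells-columnSum {a} {b} {V} q u 0 rewrite Quadruple.second (q u) = col₀ (+ suc (V u 0)) (+ a)
  where
  col₀ : ∀ Y A → (Y ℤ.+ A) ℤ.+ (ℤ.- Y ℤ.+ + 0) ≡ A
  col₀ = solve-∀
pairCells-columnSum {a} {b} {V} q u 1 rewrite Quadruple.third (q u) | Quadruple.fourth (q u) =
  col₁ (+ suc (V u 0)) (+ a) (+ b)
  where
  col₁ : ∀ Y A B → ℤ.- (Y ℤ.+ B) ℤ.+ ((Y ℤ.+ A ℤ.+ B) ℤ.+ + 0) ≡ A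
  col₁ = solve-∀
pairCells-columnSum {a} {b} {V} q u 2 rewrite Quadruple.second (q (suc u)) = col₂ (+ suc (V (suc u) 0)) (+ a)
  where
  col₂ : ∀ Y A → ℤ.- (Y ℤ.+ A) ℤ.+ (Y ℤ.+ + 0) ≡ ℤ.- A
  col₂ = solve-∀
pairCells-columnSum {a} {b} {V} q u 3 rewrite Quadruple.third (q (suc u)) | Quadruple.fourth (q (suc u)) =
  col₃ (+ suc (V (suc u) 0)) (+ a) (+ b)
  where
  col₃ : ∀ Y A B → (Y ℤ.+ B) ℤ.+ (ℤ.- (Y ℤ.+ A ℤ.+ B) ℤ.+ + 0) ≡ ℤ.- A
  col₃ = solve-∀
pairCells-columnSum q u (suc (suc (suc (suc c)))) = pairCells-columnSum q (2 + u) c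

pairCells-balanced : ∀ V k u r → countUpTo (k * 4) (λ c → positive (entry r (fill V (pairCells u c))))
                               ≡ countUpTo (k * 4) (λ c → negative (entry r (fill V (pairCells u c))))
pairCells-balanced V zero    u r                   = refl
pairCells-balanced V (suc k) u Fin.zero            = cong (_+_ 2) (pairCells-balanced V k (2 + u) Fin.zero)
pairCells-balanced V (suc k) u (Fin.suc Fin.zero)  = cong (_+_ 2) (pairCells-balanced V k (2 + u) (Fin.suc Fin.zero))

+-suc-suc : ∀ m n → m + (2 + n) ≡ 2 + (m + n)
+-suc-suc m n = trans (ℕ.+-suc m (suc n)) (cong suc (ℕ.+-suc m n))

m<m+[1+n]*2 : ∀ m n → m < m + suc n * 2
m<m+[1+n]*2 m n = ℕ.m<m+n m (s≤s z≤n)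

1+m<m+[1+n]*2 : ∀ m n → suc m < m + suc n * 2
1+m<m+[1+n]*2 m n = subst (suc m <_) (sym (+-suc-suc m (n * 2))) (s≤s (s≤s (ℕ.m≤m+n m (n * 2))))

pairCells-inRange : ∀ k u₀ r c → c < k * 4 → InRange (u₀ + k * 2) (value r (pairCells u₀ c))
pairCells-inRange (suc k) u₀ Fin.zero           0 _ = m<m+[1+n]*2 u₀ k , ℕ.<ᵇ⇒< _ _ _
pairCells-inRange (suc k) u₀ (Fin.suc Fin.zero) 0 _ = m<m+[1+n]*2 u₀ k , ℕ.<ᵇ⇒< _ _ _
pairCells-inRange (suc k) u₀ Fin.zero           1 _ = m<m+[1+n]*2 u₀ k , ℕ.<ᵇ⇒< _ _ _
pairCells-inRange (suc k) u₀ (Fin.suc Fin.zero) 1 _ = m<m+[1+n]*2 u₀ k , ℕ.<ᵇ⇒< _ _ _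
pairCells-inRange (suc k) u₀ Fin.zero           2 _ = 1+m<m+[1+n]*2 u₀ k , ℕ.<ᵇ⇒< _ _ _
pairCells-inRange (suc k) u₀ (Fin.suc Fin.zero) 2 _ = 1+m<m+[1+n]*2 u₀ k , ℕ.<ᵇ⇒< _ _ _
pairCells-inRange (suc k) u₀ Fin.zero           3 _ = 1+m<m+[1+n]*2 u₀ k , ℕ.<ᵇ⇒< _ _ _
pairCells-inRange (suc k) u₀ (Fin.suc Fin.zero) 3 _ = 1+m<m+[1+n]*2 u₀ k , ℕ.<ᵇ⇒< _ _ _
pairCells-inRange (suc k) u₀ r (suc (suc (suc (suc c)))) (s≤s (s≤s (s≤s (s≤s c<k4)))) =
  subst (λ D → InRange D (value r (pairCells (2 + u₀) c))) (sym (+-suc-suc u₀ (k * 2))) (pairCells-inRange k (2 + u₀) r c c<k4)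

pairCells-cover : ∀ k u₀ u e → u < k * 2 → e < 4 →
  ∃ λ c → ∃ λ r → c < k * 4 × value r (pairCells u₀ c) ≡ (u + u₀ , e)
pairCells-cover (suc k) u₀ 0 0 _ _ = 0 , Fin.suc Fin.zero , ℕ.<ᵇ⇒< _ _ _ , refl
pairCells-cover (suc k) u₀ 0 1 _ _ = 0 , Fin.zero         , ℕ.<ᵇ⇒< _ _ _ , refl
pairCells-cover (suc k) u₀ 0 2 _ _ = 1 , Fin.zero         , ℕ.<ᵇ⇒< _ _ _ , refl
pairCells-cover (suc k) u₀ 0 3 _ _ = 1 , Fin.suc Fin.zero , ℕ.<ᵇ⇒< _ _ _ , refl
pairCells-cover (suc k) u₀ 1 0 _ _ = 2 , Fin.suc Fin.zero , ℕ.<ᵇ⇒< _ _ _ , refl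
pairCells-cover (suc k) u₀ 1 1 _ _ = 2 , Fin.zero         , ℕ.<ᵇ⇒< _ _ _ , refl
pairCells-cover (suc k) u₀ 1 2 _ _ = 3 , Fin.zero         , ℕ.<ᵇ⇒< _ _ _ , refl
pairCells-cover (suc k) u₀ 1 3 _ _ = 3 , Fin.suc Fin.zero , ℕ.<ᵇ⇒< _ _ _ , refl
pairCells-cover (suc k) u₀ u (suc (suc (suc (suc e)))) _ (s≤s (s≤s (s≤s (s≤s ()))))
pairCells-cover (suc k) u₀ (suc (suc u)) e (s≤s (s≤s u<k2)) e<4 =
  let c , r , c<k4 , eq = pairCells-cover k (2 + u₀) u e u<k2 e<4
  in 4 + c , r , s≤s (s≤s (s≤s (s≤s c<k4))) , trans eq (cong (_, e) (+-suc-suc u u₀))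

ofParity : ℕ → (ℕ → ℤ) → ℕ → ℤ
ofParity i f c = if c % 2 ≡ᵇ i then f c else + 0

pairSums-even : ∀ a k → sumUpTo (k * 4) (ofParity 0 (pairSums a)) ≡ + 0
pairSums-even a zero    = refl
pairSums-even a (suc k) = trans (cancel (+ a) _) (pairSums-even a k)
  where
  cancel : ∀ A T → A ℤ.+ (+ 0 ℤ.+ (ℤ.- A ℤ.+ (+ 0 ℤ.+ T))) ≡ T
  cancel = solve-∀

pairSums-odd : ∀ a k → sumUpTo (k * 4) (ofParity 1 (pairSums a)) ≡ + 0
pairSums-odd a zero    = refl
pairSums-odd a (suc k) = trans (cancel (+ a) _) (pairSums-odd a k)
  where
  cancel : ∀ A T → + 0 ℤ.+ (A ℤ.+ (+ 0 ℤ.+ (ℤ.- A ℤ.+ T))) ≡ T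
  cancel = solve-∀

-- Blocks with one profile have the same column sums σ, whatever the shape of their box.
data Profile : Set where
  uniform : (a b w : ℕ) → Profile
  skew    : (w : ℕ) → Profile

offsetA offsetB : Profile → ℕ
offsetA (uniform a b w) = a
offsetA (skew w)        = 1
offsetB (uniform a b w) = b
offsetB (skew w)        = 2

data Shape : Profile → Set where
  flat    : ∀ {a b w} → Shape (uniform a b w)
  rising  : ∀ {w} → Shape (skew w)
  falling : ∀ {w} → Shape (skew w)

firstStep secondStep : ∀ {p} → Shape p → ℕ
firstStep  (flat {w = w})  = w
firstStep  (rising {w})    = w
firstStep  (falling {w})   = suc w
secondStep (flat {w = w})  = w
secondStep (rising {w})    = suc w
secondStep (falling {w})   = w

Steps : ℕ → ℕ → Table → Set
Steps w₁ w₂ V = V 1 0 ≡ V 0 0 + w₁ × V 2 0 ≡ V 1 0 + w₂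

record Fits {p} (sh : Shape p) (V : Table) : Set where
  constructor _,_
  field
    quadruples : Quadruples (offsetA p) (offsetB p) V
    steps      : Steps (firstStep sh) (secondStep sh) V

template : ∀ {p} → Shape p → ℕ → Column Cell
template _ (suc (suc (suc (suc (suc (suc c)))))) = pairCells 3 c
template flat    0 = ⁺⁻ (0 , 0) (0 , 1)
template flat    1 = ⁻⁺ (0 , 2) (1 , 1)
template flat    2 = ⁻⁺ (1 , 0) (0 , 3)
template flat    3 = ⁺⁻ (1 , 3) (2 , 3)
template flat    4 = ⁺⁻ (2 , 0) (1 , 2)
template flat    5 = ⁻⁺ (2 , 1) (2 , 2)
template rising  0 = ⁺⁻ (0 , 0) (0 , 1)
template rising  1 = ⁻⁺ (0 , 2) (1 , 0)
template rising  2 = ⁻⁺ (1 , 1) (0 , 3)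
template rising  3 = ⁺⁻ (1 , 2) (2 , 2)
template rising  4 = ⁺⁻ (2 , 1) (1 , 3)
template rising  5 = ⁻⁺ (2 , 0) (2 , 3)
template falling 0 = ⁻⁺ (2 , 3) (2 , 2)
template falling 1 = ⁺⁻ (2 , 1) (1 , 3)
template falling 2 = ⁺⁻ (1 , 2) (2 , 0)
template falling 3 = ⁻⁺ (1 , 1) (0 , 1)
template falling 4 = ⁻⁺ (0 , 2) (1 , 0)
template falling 5 = ⁺⁻ (0 , 3) (0 , 0)

σ : Profile → ℕ → ℤ
σ p (suc (suc (suc (suc (suc (suc c)))))) = pairSums (offsetA p) c
σ (uniform a b w) 0 = ℤ.- + a
σ (uniform a b w) 1 = + w ℤ.+ + a ℤ.- + b
σ (uniform a b w) 2 = + a ℤ.+ + b ℤ.- + w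
σ (uniform a b w) 3 = ℤ.- + w
σ (uniform a b w) 4 = + w ℤ.- + b
σ (uniform a b w) 5 = + b ℤ.- + a
σ (skew w) 0 = ℤ.- + 1
σ (skew w) 1 = + w ℤ.- + 2
σ (skew w) 2 = + 2 ℤ.- + w
σ (skew w) 3 = ℤ.- (+ w ℤ.+ + 1)
σ (skew w) 4 = + w ℤ.- + 1
σ (skew w) 5 = + 3

boxBase : (y w₁ w₂ : ℕ) → ℕ → ℕ
boxBase y w₁ w₂ 0 = y
boxBase y w₁ w₂ 1 = y + w₁
boxBase y w₁ w₂ _ = y + w₁ + w₂   -- used only for u = 2

record BoxSums {p} (sh : Shape p) (V : Table) : Set where
  field
    rows    : ∀ r → sumUpTo 6 (λ c → entry r (fill V (template sh c))) ≡ + 0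
    columns : ∀ c → c < 6 → columnSum (fill V (template sh c)) ≡ σ p c

canonicalBox : ∀ {p} → Shape p → ℕ → Table
canonicalBox {p} sh y u = quadrupleFrom (boxBase y (firstStep sh) (secondStep sh) u) (offsetA p) (offsetB p)

flat-box-sums : ∀ {a b w} y → BoxSums (flat {a} {b} {w}) (canonicalBox flat y)
flat-box-sums {a} {b} {w} y = record
  { rows    = λ { Fin.zero → top Y A B W ; (Fin.suc Fin.zero) → bottom Y A B W }
  ; columns = λ { 0 _ → col₀ Y A ; 1 _ → col₁ Y A B W ; 2 _ → col₂ Y A B W
                ; 3 _ → col₃ Y A B W ; 4 _ → col₄ Y B W ; 5 _ → col₅ Y A B W
                ; (suc (suc (suc (suc (suc (suc _)))))) (s≤s (s≤s (s≤s (s≤s (s≤s (s≤s ())))))) }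
  }
  where
  Y A B W : ℤ
  Y = + suc y ; A = + a ; B = + b ; W = + w
  top : ∀ Y A B W → Y ℤ.+ (ℤ.- (Y ℤ.+ B) ℤ.+ (ℤ.- (Y ℤ.+ W) ℤ.+ ((Y ℤ.+ W ℤ.+ A ℤ.+ B) ℤ.+
                      ((Y ℤ.+ W ℤ.+ W) ℤ.+ (ℤ.- (Y ℤ.+ W ℤ.+ W ℤ.+ A) ℤ.+ + 0))))) ≡ + 0
  top = solve-∀
  bottom : ∀ Y A B W → ℤ.- (Y ℤ.+ A) ℤ.+ ((Y ℤ.+ W ℤ.+ A) ℤ.+ ((Y ℤ.+ A ℤ.+ B) ℤ.+
                         (ℤ.- (Y ℤ.+ W ℤ.+ W ℤ.+ A ℤ.+ B) ℤ.+ (ℤ.- (Y ℤ.+ W ℤ.+ B) ℤ.+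
                         ((Y ℤ.+ W ℤ.+ W ℤ.+ B) ℤ.+ + 0))))) ≡ + 0
  bottom = solve-∀
  col₀ : ∀ Y A → Y ℤ.+ (ℤ.- (Y ℤ.+ A) ℤ.+ + 0) ≡ ℤ.- A
  col₀ = solve-∀
  col₁ : ∀ Y A B W → ℤ.- (Y ℤ.+ B) ℤ.+ ((Y ℤ.+ W ℤ.+ A) ℤ.+ + 0) ≡ W ℤ.+ A ℤ.- B
  col₁ = solve-∀
  col₂ : ∀ Y A B W → ℤ.- (Y ℤ.+ W) ℤ.+ ((Y ℤ.+ A ℤ.+ B) ℤ.+ + 0) ≡ A ℤ.+ B ℤ.- W
  col₂ = solve-∀
  col₃ : ∀ Y A B W → (Y ℤ.+ W ℤ.+ A ℤ.+ B) ℤ.+ (ℤ.- (Y ℤ.+ W ℤ.+ W ℤ.+ A ℤ.+ B) ℤ.+ + 0) ≡ ℤ.- W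
  col₃ = solve-∀
  col₄ : ∀ Y B W → (Y ℤ.+ W ℤ.+ W) ℤ.+ (ℤ.- (Y ℤ.+ W ℤ.+ B) ℤ.+ + 0) ≡ W ℤ.- B
  col₄ = solve-∀
  col₅ : ∀ Y A B W → ℤ.- (Y ℤ.+ W ℤ.+ W ℤ.+ A) ℤ.+ ((Y ℤ.+ W ℤ.+ W ℤ.+ B) ℤ.+ + 0) ≡ B ℤ.- A
  col₅ = solve-∀

rising-box-sums : ∀ {w} y → BoxSums (rising {w}) (canonicalBox rising y)
rising-box-sums {w} y = record
  { rows    = λ { Fin.zero → top Y W ; (Fin.suc Fin.zero) → bottom Y W }
  ; columns = λ { 0 _ → col₀ Y ; 1 _ → col₁ Y W ; 2 _ → col₂ Y W
                ; 3 _ → col₃ Y W ; 4 _ → col₄ Y W ; 5 _ → col₅ Y W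
                ; (suc (suc (suc (suc (suc (suc _)))))) (s≤s (s≤s (s≤s (s≤s (s≤s (s≤s ())))))) }
  }
  where
  Y W : ℤ
  Y = + suc y ; W = + w
  top : ∀ Y W → Y ℤ.+ (ℤ.- (Y ℤ.+ + 2) ℤ.+ (ℤ.- (Y ℤ.+ W ℤ.+ + 1) ℤ.+ ((Y ℤ.+ W ℤ.+ + 2) ℤ.+
                  ((Y ℤ.+ W ℤ.+ (+ 1 ℤ.+ W) ℤ.+ + 1) ℤ.+ (ℤ.- (Y ℤ.+ W ℤ.+ (+ 1 ℤ.+ W)) ℤ.+ + 0))))) ≡ + 0
  top = solve-∀
  bottom : ∀ Y W → ℤ.- (Y ℤ.+ + 1) ℤ.+ ((Y ℤ.+ W) ℤ.+ ((Y ℤ.+ + 1 ℤ.+ + 2) ℤ.+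
                     (ℤ.- (Y ℤ.+ W ℤ.+ (+ 1 ℤ.+ W) ℤ.+ + 2) ℤ.+ (ℤ.- (Y ℤ.+ W ℤ.+ + 1 ℤ.+ + 2) ℤ.+
                     ((Y ℤ.+ W ℤ.+ (+ 1 ℤ.+ W) ℤ.+ + 1 ℤ.+ + 2) ℤ.+ + 0))))) ≡ + 0
  bottom = solve-∀
  col₀ : ∀ Y → Y ℤ.+ (ℤ.- (Y ℤ.+ + 1) ℤ.+ + 0) ≡ ℤ.- + 1
  col₀ = solve-∀
  col₁ : ∀ Y W → ℤ.- (Y ℤ.+ + 2) ℤ.+ ((Y ℤ.+ W) ℤ.+ + 0) ≡ W ℤ.- + 2
  col₁ = solve-∀
  col₂ : ∀ Y W → ℤ.- (Y ℤ.+ W ℤ.+ + 1) ℤ.+ ((Y ℤ.+ + 1 ℤ.+ + 2) ℤ.+ + 0) ≡ + 2 ℤ.- W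
  col₂ = solve-∀
  col₃ : ∀ Y W → (Y ℤ.+ W ℤ.+ + 2) ℤ.+ (ℤ.- (Y ℤ.+ W ℤ.+ (+ 1 ℤ.+ W) ℤ.+ + 2) ℤ.+ + 0) ≡ ℤ.- (W ℤ.+ + 1)
  col₃ = solve-∀
  col₄ : ∀ Y W → (Y ℤ.+ W ℤ.+ (+ 1 ℤ.+ W) ℤ.+ + 1) ℤ.+ (ℤ.- (Y ℤ.+ W ℤ.+ + 1 ℤ.+ + 2) ℤ.+ + 0) ≡ W ℤ.- + 1
  col₄ = solve-∀
  col₅ : ∀ Y W → ℤ.- (Y ℤ.+ W ℤ.+ (+ 1 ℤ.+ W)) ℤ.+ ((Y ℤ.+ W ℤ.+ (+ 1 ℤ.+ W) ℤ.+ + 1 ℤ.+ + 2) ℤ.+ + 0) ≡ + 3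
  col₅ = solve-∀

falling-box-sums : ∀ {w} y → BoxSums (falling {w}) (canonicalBox falling y)
falling-box-sums {w} y = record
  { rows    = λ { Fin.zero → top Y W ; (Fin.suc Fin.zero) → bottom Y W }
  ; columns = λ { 0 _ → col₀ Y W ; 1 _ → col₁ Y W ; 2 _ → col₂ Y W
                ; 3 _ → col₃ Y W ; 4 _ → col₄ Y W ; 5 _ → col₅ Y
                ; (suc (suc (suc (suc (suc (suc _)))))) (s≤s (s≤s (s≤s (s≤s (s≤s (s≤s ())))))) }
  }
  where
  Y W : ℤ
  Y = + suc y ; W = + w
  top : ∀ Y W → ℤ.- (Y ℤ.+ (+ 1 ℤ.+ W) ℤ.+ W ℤ.+ + 1 ℤ.+ + 2) ℤ.+ ((Y ℤ.+ (+ 1 ℤ.+ W) ℤ.+ W ℤ.+ + 1) ℤ.+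
                  ((Y ℤ.+ (+ 1 ℤ.+ W) ℤ.+ + 2) ℤ.+ (ℤ.- (Y ℤ.+ (+ 1 ℤ.+ W) ℤ.+ + 1) ℤ.+
                  (ℤ.- (Y ℤ.+ + 2) ℤ.+ ((Y ℤ.+ + 1 ℤ.+ + 2) ℤ.+ + 0))))) ≡ + 0
  top = solve-∀
  bottom : ∀ Y W → (Y ℤ.+ (+ 1 ℤ.+ W) ℤ.+ W ℤ.+ + 2) ℤ.+ (ℤ.- (Y ℤ.+ (+ 1 ℤ.+ W) ℤ.+ + 1 ℤ.+ + 2) ℤ.+
                     (ℤ.- (Y ℤ.+ (+ 1 ℤ.+ W) ℤ.+ W) ℤ.+ ((Y ℤ.+ + 1) ℤ.+
                     ((Y ℤ.+ (+ 1 ℤ.+ W)) ℤ.+ (ℤ.- Y ℤ.+ + 0))))) ≡ + 0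
  bottom = solve-∀
  col₀ : ∀ Y W → ℤ.- (Y ℤ.+ (+ 1 ℤ.+ W) ℤ.+ W ℤ.+ + 1 ℤ.+ + 2) ℤ.+ ((Y ℤ.+ (+ 1 ℤ.+ W) ℤ.+ W ℤ.+ + 2) ℤ.+ + 0)
                 ≡ ℤ.- + 1
  col₀ = solve-∀
  col₁ : ∀ Y W → (Y ℤ.+ (+ 1 ℤ.+ W) ℤ.+ W ℤ.+ + 1) ℤ.+ (ℤ.- (Y ℤ.+ (+ 1 ℤ.+ W) ℤ.+ + 1 ℤ.+ + 2) ℤ.+ + 0)
                 ≡ W ℤ.- + 2
  col₁ = solve-∀
  col₂ : ∀ Y W → (Y ℤ.+ (+ 1 ℤ.+ W) ℤ.+ + 2) ℤ.+ (ℤ.- (Y ℤ.+ (+ 1 ℤ.+ W) ℤ.+ W) ℤ.+ + 0) ≡ + 2 ℤ.- W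
  col₂ = solve-∀
  col₃ : ∀ Y W → ℤ.- (Y ℤ.+ (+ 1 ℤ.+ W) ℤ.+ + 1) ℤ.+ ((Y ℤ.+ + 1) ℤ.+ + 0) ≡ ℤ.- (W ℤ.+ + 1)
  col₃ = solve-∀
  col₄ : ∀ Y W → ℤ.- (Y ℤ.+ + 2) ℤ.+ ((Y ℤ.+ (+ 1 ℤ.+ W)) ℤ.+ + 0) ≡ W ℤ.- + 1
  col₄ = solve-∀
  col₅ : ∀ Y → (Y ℤ.+ + 1 ℤ.+ + 2) ℤ.+ (ℤ.- Y ℤ.+ + 0) ≡ + 3
  col₅ = solve-∀

canonicalBox-sums : ∀ {p} (sh : Shape p) y → BoxSums sh (canonicalBox sh y)
canonicalBox-sums flat    = flat-box-sums
canonicalBox-sums rising  = rising-box-sums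
canonicalBox-sums falling = falling-box-sums

fits-canonicalBox : ∀ {p} {sh : Shape p} {V} → Fits sh V → ∀ u e → u < 3 → e < 4 → V u e ≡ canonicalBox sh (V 0 0) u e
fits-canonicalBox {p} {sh} {V} fits u e u<3 e<4 =
  trans (quadruple-values (Fits.quadruples fits u) e e<4) (cong (λ y → quadrupleFrom y (offsetA p) (offsetB p) e) (base u u<3))
  where
  base : ∀ u → u < 3 → V u 0 ≡ boxBase (V 0 0) (firstStep sh) (secondStep sh) u
  base 0 _ = refl
  base 1 _ = proj₁ (Fits.steps fits)
  base 2 _ = trans (proj₂ (Fits.steps fits)) (cong (_+ secondStep sh) (proj₁ (Fits.steps fits)))
  base (suc (suc (suc _))) (s≤s (s≤s (s≤s ())))

box-inRange′ : ∀ {p} (sh : Shape p) (c : Fin 6) r → InRange 3 (value r (template sh (toℕ c)))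
box-inRange′ flat    = toWitness {a? = all? λ c → all? λ r → inRange? 3 (value r (template flat    (toℕ c)))} _
box-inRange′ rising  = toWitness {a? = all? λ c → all? λ r → inRange? 3 (value r (template rising  (toℕ c)))} _
box-inRange′ falling = toWitness {a? = all? λ c → all? λ r → inRange? 3 (value r (template falling (toℕ c)))} _

box-inRange : ∀ {p} (sh : Shape p) c r → c < 6 → InRange 3 (value r (template sh c))
box-inRange sh c r c<6 = subst (λ c → InRange 3 (value r (template sh c))) (toℕ-fromℕ< c<6) (box-inRange′ sh (Fin.fromℕ< c<6) r)

box-fill-cong : ∀ {p} (sh : Shape p) {V W} → (∀ u e → u < 3 → e < 4 → V u e ≡ W u e) →
  ∀ c → c < 6 → fill V (template sh c) ≡ fill W (template sh c)
box-fill-cong sh agree c c<6 = fill-cong (template sh c) λ r →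
  let (u<3 , e<4) = box-inRange sh c r c<6 in agree _ _ u<3 e<4

boxSums-transfer : ∀ {p} {sh : Shape p} {V W} → (∀ u e → u < 3 → e < 4 → V u e ≡ W u e) → BoxSums sh W → BoxSums sh V
boxSums-transfer {sh = sh} agree sums = record
  { rows    = λ r → trans (sumUpTo-cong 6 λ c c<6 → cong (entry r) (box-fill-cong sh agree c c<6)) (BoxSums.rows sums r)
  ; columns = λ c c<6 → trans (cong columnSum (box-fill-cong sh agree c c<6)) (BoxSums.columns sums c c<6)
  }

box-sums : ∀ {p} {sh : Shape p} {V} → Fits sh V → BoxSums sh V
box-sums {sh = sh} {V} fits = boxSums-transfer (fits-canonicalBox fits) (canonicalBox-sums sh (V 0 0))

box-balanced : ∀ {p} (sh : Shape p) V r → countUpTo 6 (λ c → positive (entry r (fill V (template sh c))))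
                                        ≡ countUpTo 6 (λ c → negative (entry r (fill V (template sh c))))
box-balanced flat    V Fin.zero           = refl
box-balanced flat    V (Fin.suc Fin.zero) = refl
box-balanced rising  V Fin.zero           = refl
box-balanced rising  V (Fin.suc Fin.zero) = refl
box-balanced falling V Fin.zero           = refl
box-balanced falling V (Fin.suc Fin.zero) = refl

BoxCover : ∀ {p} → Shape p → Set
BoxCover sh = ∀ (u : Fin 3) (e : Fin 4) → ∃ λ (c : Fin 6) → ∃ λ r → value r (template sh (toℕ c)) ≡ (toℕ u , toℕ e)

boxCover? : ∀ {p} (sh : Shape p) → Dec (BoxCover sh)
boxCover? sh = all? λ u → all? λ e → any? λ c → any? λ r →
  ≡-dec ℕ._≟_ ℕ._≟_ (value r (template sh (toℕ c))) (toℕ u , toℕ e)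

box-cover′ : ∀ {p} (sh : Shape p) → BoxCover sh
box-cover′ flat    = toWitness {a? = boxCover? flat} _
box-cover′ rising  = toWitness {a? = boxCover? rising} _
box-cover′ falling = toWitness {a? = boxCover? falling} _

box-cover : ∀ {p} (sh : Shape p) u e → u < 3 → e < 4 → ∃ λ c → ∃ λ r → c < 6 × value r (template sh c) ≡ (u , e)
box-cover sh u e u<3 e<4 =
  let c , r , eq = box-cover′ sh (Fin.fromℕ< u<3) (Fin.fromℕ< e<4)
  in toℕ c , r , toℕ<n c , trans eq (cong₂ _,_ (toℕ-fromℕ< u<3) (toℕ-fromℕ< e<4))

data Split (n : ℕ) : ℕ → Set where
  below : ∀ {c} → c < n → Split n c
  above : ∀ c → Split n (n + c)

split : ∀ n c → Split n c
split n c with c ℕ.<? n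
... | yes c<n = below c<n
... | no  c≮n = subst (Split n) (ℕ.m+[n∸m]≡n (ℕ.≮⇒≥ c≮n)) (above (c ∸ n))

module _ {p} {sh : Shape p} {V : Table} (fits : Fits sh V) where

  template-rowSum : ∀ k r → sumUpTo (6 + k * 4) (λ c → entry r (fill V (template sh c))) ≡ + 0
  template-rowSum k r = trans (sumUpTo-+ 6 (k * 4) (λ c → entry r (fill V (template sh c))))
    (cong₂ ℤ._+_ (BoxSums.rows (box-sums fits) r) (pairCells-rowSum (Fits.quadruples fits) k 3 r))

  template-columnSum : ∀ c → columnSum (fill V (template sh c)) ≡ σ p c
  template-columnSum c with split 6 c
  ... | below c<6 = BoxSums.columns (box-sums fits) c c<6
  ... | above c   = pairCells-columnSum (Fits.quadruples fits) 3 c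

template-balanced : ∀ {p} (sh : Shape p) V k r →
  countUpTo (6 + k * 4) (λ c → positive (entry r (fill V (template sh c))))
    ≡ countUpTo (6 + k * 4) (λ c → negative (entry r (fill V (template sh c))))
template-balanced sh V k r = trans (countUpTo-+ 6 (k * 4) (λ c → positive (entry r (fill V (template sh c)))))
  (trans (cong₂ _+_ (box-balanced sh V r) (pairCells-balanced V k 3 r))
         (sym (countUpTo-+ 6 (k * 4) (λ c → negative (entry r (fill V (template sh c)))))))

template-inRange : ∀ {p} (sh : Shape p) k r c → c < 6 + k * 4 → InRange (3 + k * 2) (value r (template sh c))
template-inRange sh k r c c<s with split 6 c
... | below c<6 = let u<3 , e<4 = box-inRange sh c r c<6 in ℕ.≤-trans u<3 (ℕ.m≤m+n 3 (k * 2)) , e<4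
... | above c   = pairCells-inRange k 3 r c (ℕ.+-cancelˡ-< 6 c (k * 4) c<s)

template-cover : ∀ {p} (sh : Shape p) k u e → u < 3 + k * 2 → e < 4 →
  ∃ λ c → ∃ λ r → c < 6 + k * 4 × value r (template sh c) ≡ (u , e)
template-cover sh k u e u<D e<4 with split 3 u
... | below u<3 = let c , r , c<6 , eq = box-cover sh u e u<3 e<4 in c , r , ℕ.≤-trans c<6 (ℕ.m≤m+n 6 (k * 4)) , eq
... | above u   = let c , r , c<k4 , eq = pairCells-cover k 3 u e (ℕ.+-cancelˡ-< 3 u (k * 2) u<D) e<4
                  in 6 + c , r , ℕ.+-monoʳ-< 6 c<k4 , trans eq (cong (_, e) (ℕ.+-comm u 3))

σ-even : ∀ p k → sumUpTo (6 + k * 4) (ofParity 0 (σ p)) ≡ + 0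
σ-even p k = trans (sumUpTo-+ 6 (k * 4) (ofParity 0 (σ p))) (cong₂ ℤ._+_ (box p) (pairSums-even (offsetA p) k))
  where
  box : ∀ p → sumUpTo 6 (ofParity 0 (σ p)) ≡ + 0
  box (uniform a b w) = uniform-even (+ a) (+ b) (+ w)
    where
    uniform-even : ∀ A B W → ℤ.- A ℤ.+ (+ 0 ℤ.+ (A ℤ.+ B ℤ.- W ℤ.+ (+ 0 ℤ.+ (W ℤ.- B ℤ.+ (+ 0 ℤ.+ + 0))))) ≡ + 0
    uniform-even = solve-∀
  box (skew w) = skew-even (+ w)
    where
    skew-even : ∀ W → ℤ.- + 1 ℤ.+ (+ 0 ℤ.+ (+ 2 ℤ.- W ℤ.+ (+ 0 ℤ.+ (W ℤ.- + 1 ℤ.+ (+ 0 ℤ.+ + 0))))) ≡ + 0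
    skew-even = solve-∀

σ-odd : ∀ p k → sumUpTo (6 + k * 4) (ofParity 1 (σ p)) ≡ + 0
σ-odd p k = trans (sumUpTo-+ 6 (k * 4) (ofParity 1 (σ p))) (cong₂ ℤ._+_ (box p) (pairSums-odd (offsetA p) k))
  where
  box : ∀ p → sumUpTo 6 (ofParity 1 (σ p)) ≡ + 0
  box (uniform a b w) = uniform-odd (+ a) (+ b) (+ w)
    where
    uniform-odd : ∀ A B W → + 0 ℤ.+ (W ℤ.+ A ℤ.- B ℤ.+ (+ 0 ℤ.+ (ℤ.- W ℤ.+ (+ 0 ℤ.+ (B ℤ.- A ℤ.+ + 0))))) ≡ + 0
    uniform-odd = solve-∀
  box (skew w) = skew-odd (+ w)
    where
    skew-odd : ∀ W → + 0 ℤ.+ (W ℤ.- + 2 ℤ.+ (+ 0 ℤ.+ (ℤ.- (W ℤ.+ + 1) ℤ.+ (+ 0 ℤ.+ (+ 3 ℤ.+ + 0))))) ≡ + 0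
    skew-odd = solve-∀

BlockSequence : ℕ → ℕ → (ℕ → Set) → Set
BlockSequence n s S = Σ (Fin n → Block s) λ 𝓑 → ConditionD 𝓑 × (∀ x → InSupp 𝓑 x ⇔ S x)

BlockSequence-⇔ : ∀ {n s S S′} → (∀ x → S x ⇔ S′ x) → BlockSequence n s S → BlockSequence n s S′
BlockSequence-⇔ S⇔S′ (𝓑 , conditionD , support) = 𝓑 , conditionD , λ x → ⇔-trans (support x) (S⇔S′ x)

SupportOf : ℕ → ℕ → (ℕ → Table) → ℕ → Set
SupportOf n D V x = ∃ λ b → ∃ λ u → ∃ λ e → b < n × u < D × e < 4 × suc (V b u e) ≡ x

module TemplateBlocks {p} (n k : ℕ) (V : ℕ → Table) (shape : ℕ → Shape p) (fits : ∀ b → Fits (shape b) (V b)) where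

  column : ℕ → ℕ → Column ℕ
  column b = fill (V b) ∘ template (shape b)

  blocks : Fin n → Block (6 + k * 4)
  blocks q r c = entry r (column (toℕ q) (toℕ c))

  row-shiftable : ∀ q r → #pos (blocks q r) ≡ #neg (blocks q r)
  row-shiftable q r = trans (length-filter-allFin (+ 0 ℤ.<?_) (6 + k * 4) (entry r ∘ column (toℕ q)))
    (trans (template-balanced (shape (toℕ q)) (V (toℕ q)) k r)
           (sym (length-filter-allFin (λ x → x ℤ.<? + 0) (6 + k * 4) (entry r ∘ column (toℕ q)))))

  row-sum : ∀ q r → sumℤ (blocks q r) ≡ + 0
  row-sum q r = trans (sumℤ-toℕ (6 + k * 4) (entry r ∘ column (toℕ q))) (template-rowSum (fits (toℕ q)) k r)

  blocks-conditionD : ConditionD blocks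
  blocks-conditionD = σ p ∘ toℕ
                    , trans (sumℤ-toℕ (6 + k * 4) (ofParity 0 (σ p))) (σ-even p k)
                    , trans (sumℤ-toℕ (6 + k * 4) (ofParity 1 (σ p))) (σ-odd p k)
                    , λ q → (row-shiftable q , λ c → column-shiftable (column (toℕ q) (toℕ c)))
                          , row-sum q
                          , λ c → template-columnSum (fits (toℕ q)) (toℕ c)

  blocks-support : ∀ x → InSupp blocks x ⇔ SupportOf n (3 + k * 2) V x
  blocks-support x = mk⇔ to from
    where
    to : InSupp blocks x → SupportOf n (3 + k * 2) V x
    to (q , r , c , eq) =
      let u<D , e<4 = template-inRange (shape (toℕ q)) k r (toℕ c) (toℕ<n c)
      in toℕ q , _ , _ , toℕ<n q , u<D , e<4 , trans (sym (∣entry-fill∣ (V (toℕ q)) r (template (shape (toℕ q)) (toℕ c)))) eq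
    from : SupportOf n (3 + k * 2) V x → InSupp blocks x
    from (b , u , e , b<n , u<D , e<4 , eq) with template-cover (shape b) k u e u<D e<4
    ... | c , r , c<s , cell≡ = Fin.fromℕ< b<n , r , Fin.fromℕ< c<s , value≡x
      where
      value≡x : ∣ blocks (Fin.fromℕ< b<n) r (Fin.fromℕ< c<s) ∣ ≡ x
      value≡x rewrite toℕ-fromℕ< b<n | toℕ-fromℕ< c<s =
        trans (∣entry-fill∣ (V b) r (template (shape b) c)) (trans (cong (suc ∘ uncurry (V b)) cell≡) eq)

blocks-from-tables : ∀ {p} n k (V : ℕ → Table) (shape : ℕ → Shape p) → (∀ b → Fits (shape b) (V b)) →
  BlockSequence n (6 + k * 4) (SupportOf n (3 + k * 2) V)
blocks-from-tables n k V shape fits = blocks , blocks-conditionD , blocks-support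
  where open TemplateBlocks n k V shape fits

-- Tiling a grid by blocks and quadruples

*+-< : ∀ {i R d r} → i < R → d < r → i * r + d < R * r
*+-< {i} {R} {d} {r} i<R d<r =
  ℕ.≤-trans (ℕ.+-monoʳ-< (i * r) d<r) (subst (_≤ R * r) (ℕ.+-comm r (i * r)) (ℕ.*-monoˡ-≤ r i<R))

[m*n+o]/n≡m : ∀ m {n o} .{{_ : ℕ.NonZero n}} → o < n → (m * n + o) / n ≡ m
[m*n+o]/n≡m m {n} {o} o<n =
  trans (+-distrib-/-∣ˡ o (n∣m*n m)) (trans (cong₂ _+_ (m*n/n≡m m n) (m<n⇒m/n≡0 o<n)) (ℕ.+-identityʳ m))

[m*n+o]%n≡o : ∀ m {n o} .{{_ : ℕ.NonZero n}} → o < n → (m * n + o) % n ≡ o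
[m*n+o]%n≡o m {n} {o} o<n = trans (%-remove-+ˡ o (n∣m*n m)) (m<n⇒m%n≡m o<n)

m/n*n+m%n≡m : ∀ m n .{{_ : ℕ.NonZero n}} → m / n * n + m % n ≡ m
m/n*n+m%n≡m m n = sym (trans (m≡m%n+[m/n]*n m n) (ℕ.+-comm (m % n) _))

place : (r c : ℕ) .{{_ : ℕ.NonZero c}} → ℕ × ℕ → ℕ → ℕ × ℕ
place r c (i , j) e = i * r + e / c , j * c + e % c

place-bounded : ∀ {R C} r c .{{_ : ℕ.NonZero c}} {i j e} → i < R → j < C → e < r * c →
  proj₁ (place r c (i , j) e) < R * r × proj₂ (place r c (i , j) e) < C * c
place-bounded r c {e = e} i<R j<C e<rc = *+-< i<R (m<n*o⇒m/o<n e<rc) , *+-< j<C (m%n<n e c)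

place-surjective : ∀ {R C} r c .{{_ : ℕ.NonZero r}} .{{_ : ℕ.NonZero c}} {A J} → A < R * r → J < C * c →
  ∃ λ i → ∃ λ j → ∃ λ e → i < R × j < C × e < r * c × place r c (i , j) e ≡ (A , J)
place-surjective r c {A} {J} A<Rr J<Cc =
  A / r , J / c , A % r * c + J % c , m<n*o⇒m/o<n A<Rr , m<n*o⇒m/o<n J<Cc , *+-< (m%n<n A r) (m%n<n J c) ,
  cong₂ _,_ (trans (cong (_+_ (A / r * r)) ([m*n+o]/n≡m (A % r) (m%n<n J c))) (m/n*n+m%n≡m A r))
            (trans (cong (_+_ (J / c * c)) ([m*n+o]%n≡o (A % r) (m%n<n J c))) (m/n*n+m%n≡m J c))

GridSupport : ℕ → ℕ → (ℕ → ℕ) → ℕ → Set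
GridSupport P Q ρ x = ∃ λ A → ∃ λ J → A < P × J < Q × suc (ρ A + J) ≡ x

GridSupport-cong : ∀ {P P′ Q Q′ ρ x} → P ≡ P′ → Q ≡ Q′ → GridSupport P Q ρ x ⇔ GridSupport P′ Q′ ρ x
GridSupport-cong refl refl = ⇔-refl

-- Block b is tile (b / nbc , b % nbc) of an nbr × nbc grid, its quadruple u is tile (u / h , u % h) of a g × h
-- grid inside it, and element e of the quadruple is cell (e / pJ , e % pJ) of a pA × pJ tile; cell (A , J) of the
-- resulting grid holds the value ρ A + J.
module Layout (nbr nbc g h pA pJ : ℕ) .{{_ : ℕ.NonZero nbr}} .{{_ : ℕ.NonZero nbc}} .{{_ : ℕ.NonZero g}}
              .{{_ : ℕ.NonZero h}} .{{_ : ℕ.NonZero pA}} .{{_ : ℕ.NonZero pJ}} (ρ : ℕ → ℕ) where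

  tile : ℕ → ℕ → ℕ × ℕ
  tile b u = place g h (place nbr nbc (0 , 0) b) u

  position : ℕ → ℕ → ℕ → ℕ × ℕ
  position b u e = place pA pJ (tile b u) e

  table : ℕ → Table
  table b u e = ρ (proj₁ (position b u e)) + proj₂ (position b u e)

  support : pA * pJ ≡ 4 → ∀ x → SupportOf (nbr * nbc) (g * h) table x ⇔ GridSupport (nbr * g * pA) (nbc * h * pJ) ρ x
  support pApJ≡4 x = mk⇔ to from
    where
    to : SupportOf (nbr * nbc) (g * h) table x → GridSupport (nbr * g * pA) (nbc * h * pJ) ρ x
    to (b , u , e , b<n , u<D , e<4 , eq) =
      let i₀< , j₀< = place-bounded {R = 1} {C = 1} nbr nbc {0} {0} (s≤s z≤n) (s≤s z≤n) b<n
          i₁< , j₁< = place-bounded g h (subst (b / nbc <_) (ℕ.*-identityˡ nbr) i₀<)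
                                        (subst (b % nbc <_) (ℕ.*-identityˡ nbc) j₀<) u<D
          A< , J< = place-bounded pA pJ i₁< j₁< (subst (e <_) (sym pApJ≡4) e<4)
      in _ , _ , A< , J< , eq
    from : GridSupport (nbr * g * pA) (nbc * h * pJ) ρ x → SupportOf (nbr * nbc) (g * h) table x
    from (A , J , A< , J< , eq) with place-surjective pA pJ A< J<
    ... | i₁ , j₁ , e , i₁< , j₁< , e< , position≡ with place-surjective g h i₁< j₁<
    ... | i₀ , j₀ , u , i₀< , j₀< , u< , tile≡
        with place-surjective {R = 1} {C = 1} nbr nbc (subst (i₀ <_) (sym (ℕ.*-identityˡ nbr)) i₀<)
                                                      (subst (j₀ <_) (sym (ℕ.*-identityˡ nbc)) j₀<)
    ... | 0 , 0 , b , s≤s z≤n , s≤s z≤n , b< , block≡ =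
      b , u , e , b< , u< , subst (e <_) pApJ≡4 e< , trans (cong (λ (A , J) → suc (ρ A + J)) table≡) eq
      where
      table≡ : position b u e ≡ (A , J)
      table≡ = trans (cong (λ t → place pA pJ (place g h t u) e) block≡)
                     (trans (cong (λ t → place pA pJ t e) tile≡) position≡)

data OddSize : ℕ → Set where
  one  : OddSize 1
  wide : ∀ h → OddSize (3 + h)

data Tile : Set where
  horizontal vertical square : Tile

height width : Tile → ℕ
height horizontal = 1
height vertical   = 4
height square     = 2
width horizontal  = 4
width vertical    = 1
width square      = 2

instance
  height-nonZero : ∀ {t} → ℕ.NonZero (height t)
  height-nonZero {horizontal} = _
  height-nonZero {vertical}   = _
  height-nonZero {square}     = _
  width-nonZero : ∀ {t} → ℕ.NonZero (width t)
  width-nonZero {horizontal} = _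
  width-nonZero {vertical}   = _
  width-nonZero {square}     = _

height*width≡4 : ∀ t → height t * width t ≡ 4
height*width≡4 horizontal = refl
height*width≡4 vertical   = refl
height*width≡4 square     = refl

horizontal-quadruple : ∀ (ρ : ℕ → ℕ) I J → Quadruple 1 2 (λ e → ρ (I * 1 + e / 4) + (J * 4 + e % 4))
horizontal-quadruple ρ I J = record { second = +1 X (J * 4) ; third = +2 X (J * 4) ; fourth = +3 X (J * 4) }
  where
  X : ℕ
  X = ρ (I * 1 + 0)
  +1 : ∀ X Z → X + (Z + 1) ≡ X + (Z + 0) + 1
  +1 = ℕ-Solver.solve-∀
  +2 : ∀ X Z → X + (Z + 2) ≡ X + (Z + 0) + 2
  +2 = ℕ-Solver.solve-∀
  +3 : ∀ X Z → X + (Z + 3) ≡ X + (Z + 0) + 1 + 2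
  +3 = ℕ-Solver.solve-∀

tileOffsetA tileOffsetB : Tile → ℕ → ℕ
tileOffsetA horizontal l = 1
tileOffsetA vertical   l = l
tileOffsetA square     l = 1
tileOffsetB horizontal l = 2
tileOffsetB vertical   l = l + l
tileOffsetB square     l = l

linear-quadruple : ∀ t l I J →
  Quadruple (tileOffsetA t l) (tileOffsetB t l) (λ e → (I * height t + e / width t) * l + (J * width t + e % width t))
linear-quadruple horizontal l I J = horizontal-quadruple (_* l) I J
linear-quadruple vertical l I J = record { second = +l I J l ; third = +2l I J l ; fourth = +3l I J l }
  where
  +l : ∀ I J l → (I * 4 + 1) * l + (J * 1 + 0) ≡ (I * 4 + 0) * l + (J * 1 + 0) + l
  +l = ℕ-Solver.solve-∀
  +2l : ∀ I J l → (I * 4 + 2) * l + (J * 1 + 0) ≡ (I * 4 + 0) * l + (J * 1 + 0) + (l + l)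
  +2l = ℕ-Solver.solve-∀
  +3l : ∀ I J l → (I * 4 + 3) * l + (J * 1 + 0) ≡ (I * 4 + 0) * l + (J * 1 + 0) + l + (l + l)
  +3l = ℕ-Solver.solve-∀
linear-quadruple square l I J = record { second = +1 I J l ; third = +l I J l ; fourth = +1+l I J l }
  where
  +1 : ∀ I J l → (I * 2 + 0) * l + (J * 2 + 1) ≡ (I * 2 + 0) * l + (J * 2 + 0) + 1
  +1 = ℕ-Solver.solve-∀
  +l : ∀ I J l → (I * 2 + 1) * l + (J * 2 + 0) ≡ (I * 2 + 0) * l + (J * 2 + 0) + l
  +l = ℕ-Solver.solve-∀
  +1+l : ∀ I J l → (I * 2 + 1) * l + (J * 2 + 1) ≡ (I * 2 + 0) * l + (J * 2 + 0) + 1 + l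
  +1+l = ℕ-Solver.solve-∀

linearStep : Tile → ℕ → ∀ {h} → OddSize h → ℕ
linearStep t l one      = height t * l
linearStep t l (wide _) = width t

oddRowStart : ℕ → ℕ → ℕ
oddRowStart M 0 = 0
oddRowStart M 1 = M
oddRowStart M (suc (suc A)) = oddRowStart M A + suc (M + M)

oddShape : ∀ {M} → ℕ → Shape (skew M)
oddShape 0             = rising
oddShape 1             = falling
oddShape (suc (suc A)) = oddShape A

oddRowStart-suc : ∀ M A → oddRowStart M (suc A) ≡ oddRowStart M A + firstStep (oddShape {M} A)
oddRowStart-suc M 0             = refl
oddRowStart-suc M 1             = sym (ℕ.+-suc M M)
oddRowStart-suc M (suc (suc A)) =
  trans (cong (_+ suc (M + M)) (oddRowStart-suc M A)) (xy∙z≈xz∙y (oddRowStart M A) (firstStep (oddShape {M} A)) (suc (M + M)))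

secondStep≡firstStep-next : ∀ M A → secondStep (oddShape {M} A) ≡ firstStep (oddShape {M} (suc A))
secondStep≡firstStep-next M 0             = refl
secondStep≡firstStep-next M 1             = refl
secondStep≡firstStep-next M (suc (suc A)) = secondStep≡firstStep-next M A

row-shift : ∀ (ρ : ℕ → ℕ) {A A′ Y} W s → A ≡ Y → A′ ≡ suc Y → ρ (suc Y) ≡ ρ Y + s →
  ρ A′ + W ≡ ρ A + W + s
row-shift ρ {Y = Y} W s refl refl step = trans (cong (_+ W) step) (xy∙z≈xz∙y (ρ Y) s W)

oddProfile : ∀ {h} → OddSize h → ℕ → Profile
oddProfile one      M = skew M
oddProfile (wide _) M = uniform 1 2 4

module _ (nbr nbc g : ℕ) .{{_ : ℕ.NonZero nbr}} .{{_ : ℕ.NonZero nbc}} .{{_ : ℕ.NonZero g}} where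

  wide-steps : ∀ h pA pJ .{{_ : ℕ.NonZero pA}} .{{_ : ℕ.NonZero pJ}} (ρ : ℕ → ℕ) b →
    Steps pJ pJ (Layout.table nbr nbc g (3 + h) pA pJ ρ b)
  wide-steps h pA pJ ρ b = next-column Y Z 0 pJ (0 % pJ) , next-column Y Z 1 pJ (0 % pJ)
    where
    Y Z : ℕ
    Y = ρ ((b / nbc * g + 0) * pA + 0 / pJ)
    Z = b % nbc * (3 + h)
    next-column : ∀ Y Z i p z → Y + ((Z + suc i) * p + z) ≡ Y + ((Z + i) * p + z) + p
    next-column = ℕ-Solver.solve-∀

  narrow-linear-steps : ∀ pA pJ .{{_ : ℕ.NonZero pA}} .{{_ : ℕ.NonZero pJ}} l b →
    Steps (pA * l) (pA * l) (Layout.table nbr nbc g 1 pA pJ (_* l) b)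
  narrow-linear-steps pA pJ l b = next-row X 0 pA (0 / pJ) l W , next-row X 1 pA (0 / pJ) l W
    where
    X W : ℕ
    X = b / nbc * g
    W = (b % nbc * 1 + 0) * pJ + 0 % pJ
    next-row : ∀ X i p z l W → ((X + suc i) * p + z) * l + W ≡ ((X + i) * p + z) * l + W + p * l
    next-row = ℕ-Solver.solve-∀

  linear-fits : ∀ t l {h} .{{_ : ℕ.NonZero h}} (hs : OddSize h) b →
    Fits (flat {tileOffsetA t l} {tileOffsetB t l} {linearStep t l hs}) (Layout.table nbr nbc g h (height t) (width t) (_* l) b)
  linear-fits t l {h} hs b = (λ u → linear-quadruple t l (b / nbc * g + u / h) (b % nbc * h + u % h)) , steps hs
    where
    steps : ∀ {h} .{{_ : ℕ.NonZero h}} (hs : OddSize h) →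
      Steps (linearStep t l hs) (linearStep t l hs) (Layout.table nbr nbc g h (height t) (width t) (_* l) b)
    steps one      = narrow-linear-steps (height t) (width t) l b
    steps (wide h) = wide-steps h (height t) (width t) (_* l) b

  oddShapes : ∀ {h} (hs : OddSize h) M → ℕ → Shape (oddProfile hs M)
  oddShapes one      M b = oddShape (b / nbc * g + 0)   -- the grid row of quadruple 0 of block b
  oddShapes (wide _) M b = flat

  odd-quadruples : ∀ M h .{{_ : ℕ.NonZero h}} b → Quadruples 1 2 (Layout.table nbr nbc g h 1 4 (oddRowStart M) b)
  odd-quadruples M h b u = horizontal-quadruple (oddRowStart M) (b / nbc * g + u / h) (b % nbc * h + u % h)

  odd-fits : ∀ M {h} .{{_ : ℕ.NonZero h}} (hs : OddSize h) b →
    Fits (oddShapes hs M b) (Layout.table nbr nbc g h 1 4 (oddRowStart M) b)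
  odd-fits M one b = odd-quadruples M 1 b ,
    ( row-shift (oddRowStart M) W _ (row₀ (b / nbc * g)) (row₁ (b / nbc * g)) (oddRowStart-suc M X)
    , row-shift (oddRowStart M) W _ (row₁ (b / nbc * g)) (row₂ (b / nbc * g))
        (trans (oddRowStart-suc M (suc X)) (cong (_+_ (oddRowStart M (suc X))) (sym (secondStep≡firstStep-next M X)))))
    where
    X W : ℕ
    X = b / nbc * g + 0
    W = (b % nbc * 1 + 0) * 4 + 0
    row₀ : ∀ X → (X + 0) * 1 + 0 ≡ X + 0
    row₀ = ℕ-Solver.solve-∀
    row₁ : ∀ X → (X + 1) * 1 + 0 ≡ suc (X + 0)
    row₁ = ℕ-Solver.solve-∀
    row₂ : ∀ X → (X + 2) * 1 + 0 ≡ suc (suc (X + 0))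
    row₂ = ℕ-Solver.solve-∀
  odd-fits M (wide h) b = odd-quadruples M (3 + h) b , wide-steps h 1 4 (oddRowStart M) b

-- The grids of the target supports

Target : (N K l : ℕ) → ℕ → Set
Target N K l x = (1 ≤ x × x ≤ N) × ¬ (∃ λ j → (1 ≤ j × j ≤ K) × x ≡ j * l)

Target-cong : ∀ {N N′ K l l′ x} → N ≡ N′ → l ≡ l′ → Target N K l x ⇔ Target N′ K l′ x
Target-cong refl refl = ⇔-refl

not-multiple : ∀ {L r} a j → r < L → suc (a * suc L + r) ≢ j * suc L
not-multiple {L} {r} a j r<L eq = ℕ.1+n≢0
  (trans (sym ([m*n+o]%n≡o a (s≤s r<L))) (trans (cong (_% suc L) (trans (ℕ.+-suc (a * suc L) r) eq)) (m*n%n≡0 j (suc L))))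

target-intro : ∀ {N K L} a {r} → r < L → suc (a * suc L + r) ≤ N → Target N K (suc L) (suc (a * suc L + r))
target-intro a r<L bound = (s≤s z≤n , bound) , λ (j , _ , eq) → not-multiple a j r<L eq

target-elim : ∀ {N K L x} → Target N K (suc L) x → N < suc K * suc L →
  ∃ λ a → ∃ λ r → a ≤ K × r < L × x ≡ suc (a * suc L + r)
target-elim {N} {K} {L} {suc y} ((_ , x≤N) , no-multiple) N< = a , r , a≤K , r<L , cong suc y≡
  where
  l a r : ℕ
  l = suc L
  a = y / l
  r = y % l
  y≡ : y ≡ a * l + r
  y≡ = sym (m/n*n+m%n≡m y l)
  x<[1+K]l : suc y < suc K * l
  x<[1+K]l = ℕ.≤-<-trans x≤N N<
  a≤K : a ≤ K
  a≤K = ℕ.s≤s⁻¹ (ℕ.*-cancelʳ-< l a (suc K)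
          (ℕ.≤-<-trans (ℕ.m≤m+n (a * l) r) (subst (_< suc K * l) y≡ (ℕ.<-trans (ℕ.n<1+n y) x<[1+K]l))))
  r<L : r < L
  r<L = ℕ.≤∧≢⇒< (ℕ.s≤s⁻¹ (m%n<n y l)) λ r≡L →
    let x≡ : suc y ≡ suc a * l
        x≡ = trans (cong suc (trans y≡ (cong (_+_ (a * l)) r≡L))) (cong suc (ℕ.+-comm (a * l) L))
    in no-multiple (suc a , (s≤s z≤n , ℕ.s≤s⁻¹ (ℕ.*-cancelʳ-< l (suc a) (suc K) (subst (_< suc K * l) x≡ x<[1+K]l)))
                   , x≡)

linearGrid-support : ∀ Q L x → GridSupport Q L (_* suc L) x ⇔ Target (Q * suc L) Q (suc L) x
linearGrid-support Q L x = mk⇔ to from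
  where
  to : GridSupport Q L (_* suc L) x → Target (Q * suc L) Q (suc L) x
  to (A , J , A<Q , J<L , refl) = target-intro A J<L (*+-< A<Q (ℕ.m<n⇒m<1+n J<L))
  from : Target (Q * suc L) Q (suc L) x → GridSupport Q L (_* suc L) x
  from target with target-elim target (ℕ.m<n+m (Q * suc L) (s≤s z≤n))
  ... | a , r , _ , r<L , refl = a , r , a<Q , r<L , refl
    where
    a<Q : a < Q
    a<Q = ℕ.*-cancelʳ-< (suc L) a Q (ℕ.≤-<-trans (ℕ.m≤m+n (a * suc L) r) (proj₂ (proj₁ target)))

data Parity : ℕ → Set where
  even : ∀ a → Parity (a * 2)
  odd  : ∀ a → Parity (suc (a * 2))

parity : ∀ A → Parity A
parity 0 = even 0
parity 1 = odd 0
parity (suc (suc A)) with parity A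
... | even a = even (suc a)
... | odd a  = odd (suc a)

oddRowStart-even : ∀ M a → oddRowStart M (a * 2) ≡ a * suc (M + M)
oddRowStart-even M zero    = refl
oddRowStart-even M (suc a) = trans (cong (_+ suc (M + M)) (oddRowStart-even M a)) (ℕ.+-comm (a * suc (M + M)) _)

oddRowStart-odd : ∀ M a → oddRowStart M (suc (a * 2)) ≡ a * suc (M + M) + M
oddRowStart-odd M zero    = refl
oddRowStart-odd M (suc a) = trans (cong (_+ suc (M + M)) (oddRowStart-odd M a)) (rearrange (a * suc (M + M)) M (suc (M + M)))
  where
  rearrange : ∀ x M l → x + M + l ≡ l + x + M
  rearrange = ℕ-Solver.solve-∀

oddGrid→target : ∀ H M x → GridSupport (suc (H * 2)) M (oddRowStart M) x → Target (H * suc (M + M) + M) H (suc (M + M)) x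
oddGrid→target H M x (A , J , A< , J<M , refl) with parity A
... | even a = subst (Target (H * l + M) H l) (cong (λ o → suc (o + J)) (sym (oddRowStart-even M a)))
                 (target-intro a (ℕ.≤-trans J<M (ℕ.m≤m+n M M))
                    (subst (_≤ H * l + M) (ℕ.+-suc (a * l) J) (ℕ.+-mono-≤ (ℕ.*-monoˡ-≤ l a≤H) J<M)))
  where
  l : ℕ
  l = suc (M + M)
  a≤H : a ≤ H
  a≤H = ℕ.*-cancelʳ-≤ a H 2 (ℕ.s≤s⁻¹ A<)
... | odd a  = subst (Target (H * l + M) H l) (cong suc (trans (sym (ℕ.+-assoc (a * l) M J)) (cong (_+ J) (sym (oddRowStart-odd M a)))))
                 (target-intro a M+J<M+M (ℕ.≤-trans (*+-< a<H (ℕ.m<n⇒m<1+n M+J<M+M)) (ℕ.m≤m+n (H * l) M)))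
  where
  l : ℕ
  l = suc (M + M)
  a<H : a < H
  a<H = ℕ.*-cancelʳ-< 2 a H (ℕ.s<s⁻¹ A<)
  M+J<M+M : M + J < M + M
  M+J<M+M = ℕ.+-monoʳ-< M J<M

H*l+M<[1+H]*l : ∀ H M → H * suc (M + M) + M < suc H * suc (M + M)
H*l+M<[1+H]*l H M =
  subst (H * suc (M + M) + M <_) (ℕ.+-comm (H * suc (M + M)) _) (ℕ.+-monoʳ-< (H * suc (M + M)) (s≤s (ℕ.m≤m+n M M)))

target→oddGrid : ∀ H M x → Target (H * suc (M + M) + M) H (suc (M + M)) x → GridSupport (suc (H * 2)) M (oddRowStart M) x
target→oddGrid H M x target with target-elim target (H*l+M<[1+H]*l H M)
... | a , r , a≤H , r<M+M , refl with r ℕ.<? M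
...   | yes r<M = a * 2 , r , s≤s (ℕ.*-monoˡ-≤ 2 a≤H) , r<M , cong (λ o → suc (o + r)) (oddRowStart-even M a)
...   | no r≮M  = suc (a * 2) , r ∸ M , s≤s (ℕ.*-monoˡ-< 2 a<H) , r∸M<M , cong suc value≡
  where
  l : ℕ
  l = suc (M + M)
  M≤r : M ≤ r
  M≤r = ℕ.≮⇒≥ r≮M
  r∸M<M : r ∸ M < M
  r∸M<M = ℕ.+-cancelˡ-< M (r ∸ M) M (subst (_< M + M) (sym (ℕ.m+[n∸m]≡n M≤r)) r<M+M)
  a<H : a < H
  a<H = ℕ.≤∧≢⇒< a≤H λ { refl →
    ℕ.<⇒≱ (subst (H * l + M <_) (ℕ.+-suc (H * l) r) (ℕ.+-monoʳ-< (H * l) (s≤s M≤r))) (proj₂ (proj₁ target)) }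
  value≡ : oddRowStart M (suc (a * 2)) + (r ∸ M) ≡ a * l + r
  value≡ = trans (cong (_+ (r ∸ M)) (oddRowStart-odd M a))
                 (trans (ℕ.+-assoc (a * l) M (r ∸ M)) (cong (_+_ (a * l)) (ℕ.m+[n∸m]≡n M≤r)))

oddGrid-support : ∀ H M x → GridSupport (suc (H * 2)) M (oddRowStart M) x ⇔ Target (H * suc (M + M) + M) H (suc (M + M)) x
oddGrid-support H M x = mk⇔ (oddGrid→target H M x) (target→oddGrid H M x)

-- Arithmetic of the parameters

record Factorization (R C n D : ℕ) : Set where
  field
    g h nbr nbc : ℕ
    g*h≡D       : g * h ≡ D
    R≡nbr*g     : R ≡ nbr * g
    C≡nbc*h     : C ≡ nbc * h
    nbr*nbc≡n   : nbr * nbc ≡ n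
    g≢0         : ℕ.NonZero g
    h≢0         : ℕ.NonZero h
    nbr≢0       : ℕ.NonZero nbr
    nbc≢0       : ℕ.NonZero nbc

  instance
    g-nonZero : ℕ.NonZero g
    g-nonZero = g≢0
    h-nonZero : ℕ.NonZero h
    h-nonZero = h≢0
    nbr-nonZero : ℕ.NonZero nbr
    nbr-nonZero = nbr≢0
    nbc-nonZero : ℕ.NonZero nbc
    nbc-nonZero = nbc≢0

-- With g = gcd D R, h = D / g is coprime to nbr = R / g and divides nbr C = n h, hence divides C.
factorization : ∀ R C n D → R * C ≡ n * D → D ≢ 0 → n ≢ 0 → Factorization R C n D
factorization R C n D RC≡nD D≢0 n≢0 with gcd[m,n]∣m D R | gcd[m,n]∣n D R
... | divides h D≡h*g | divides nbr R≡nbr*g = record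
  { g = g ; h = h ; nbr = nbr ; nbc = nbc
  ; g*h≡D = trans (ℕ.*-comm g h) (sym D≡h*g) ; R≡nbr*g = R≡nbr*g ; C≡nbc*h = C≡nbc*h ; nbr*nbc≡n = nbr*nbc≡n
  ; g≢0 = g≢0 ; h≢0 = h≢0
  ; nbr≢0 = ℕ.≢-nonZero λ nbr≡0 → n≢0 (trans (sym nbr*nbc≡n) (cong (_* nbc) nbr≡0))
  ; nbc≢0 = ℕ.≢-nonZero λ nbc≡0 → n≢0 (trans (sym nbr*nbc≡n) (trans (cong (nbr *_) nbc≡0) (ℕ.*-zeroʳ nbr)))
  }
  where
  g : ℕ
  g = gcd D R
  g≢0 : ℕ.NonZero g
  g≢0 = ℕ.≢-nonZero (D≢0 ∘ gcd[m,n]≡0⇒m≡0)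
  h≢0 : ℕ.NonZero h
  h≢0 = ℕ.≢-nonZero λ h≡0 → D≢0 (trans D≡h*g (cong (_* g) h≡0))
  coprime : Coprime h nbr
  coprime = subst₂ Coprime (trans (cong (λ D → (D / g) {{g≢0}}) D≡h*g) (m*n/n≡m h g {{g≢0}}))
                           (trans (cong (λ R → (R / g) {{g≢0}}) R≡nbr*g) (m*n/n≡m nbr g {{g≢0}}))
                           (coprime-/gcd D R {{g≢0}})
  nbr*C≡n*h : nbr * C ≡ n * h
  nbr*C≡n*h = ℕ.*-cancelʳ-≡ (nbr * C) (n * h) g {{g≢0}}
    (trans (swap nbr C g) (trans (cong (_* C) (sym R≡nbr*g)) (trans RC≡nD (trans (cong (n *_) D≡h*g) (sym (ℕ.*-assoc n h g))))))
    where
    swap : ∀ x y z → x * y * z ≡ x * z * y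
    swap = ℕ-Solver.solve-∀
  nbc : ℕ
  nbc = _∣_.quotient (coprime-divisor coprime (divides n nbr*C≡n*h))
  C≡nbc*h : C ≡ nbc * h
  C≡nbc*h = _∣_.equality (coprime-divisor coprime (divides n nbr*C≡n*h))
  nbr*nbc≡n : nbr * nbc ≡ n
  nbr*nbc≡n = ℕ.*-cancelʳ-≡ (nbr * nbc) n h {{h≢0}}
                (trans (ℕ.*-assoc nbr nbc h) (trans (cong (nbr *_) (sym C≡nbc*h)) nbr*C≡n*h))

even≢odd : ∀ a b → a * 2 ≢ suc (b * 2)
even≢odd (suc a) (suc b) eq = even≢odd a b (ℕ.suc-injective (ℕ.suc-injective eq))
even≢odd (suc zero) zero ()
even≢odd (suc (suc a)) zero ()

odd*odd : ∀ a b → suc (a * 2) * suc (b * 2) ≡ suc ((a * b * 2 + a + b) * 2)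
odd*odd = ℕ-Solver.solve-∀

odd-factor : ∀ a n m → suc (a * 2) * n ≡ m * 2 → ∃ λ n′ → n ≡ n′ * 2 × suc (a * 2) * n′ ≡ m
odd-factor a n m eq with parity n
... | even n′ = n′ , refl , ℕ.*-cancelʳ-≡ (suc (a * 2) * n′) m 2 (trans (ℕ.*-assoc (suc (a * 2)) n′ 2) eq)
... | odd n′  = ⊥-elim (even≢odd m (a * n′ * 2 + a + n′) (trans (sym eq) (odd*odd a n′)))

m*2^[1+k]≡m*2^k*2 : ∀ m k → m * 2 ^ suc k ≡ m * 2 ^ k * 2
m*2^[1+k]≡m*2^k*2 m k = reassoc m (2 ^ k)
  where
  reassoc : ∀ x y → x * (2 * y) ≡ x * y * 2
  reassoc = ℕ-Solver.solve-∀

odd-factor-2^ : ∀ k a n m → suc (a * 2) * n ≡ m * 2 ^ k → ∃ λ n′ → n ≡ n′ * 2 ^ k × suc (a * 2) * n′ ≡ m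
odd-factor-2^ zero    a n m eq = n , sym (ℕ.*-identityʳ n) , trans eq (ℕ.*-identityʳ m)
odd-factor-2^ (suc k) a n m eq with odd-factor a n (m * 2 ^ k) (trans eq (m*2^[1+k]≡m*2^k*2 m k))
... | n₁ , refl , eq₁ with odd-factor-2^ k a n₁ m eq₁
... | n′ , refl , eq′ = n′ , sym (m*2^[1+k]≡m*2^k*2 n′ k) , eq′

oddSize : ∀ g h k → g * h ≡ 3 + k * 2 → OddSize h
oddSize g 0                   k eq = ⊥-elim (ℕ.1+n≢0 (trans (sym eq) (ℕ.*-zeroʳ g)))
oddSize g 1                   k eq = one
oddSize g 2                   k eq = ⊥-elim (even≢odd g (suc k) eq)
oddSize g (suc (suc (suc h))) k eq = wide h

s≡6+k*4 : ∀ s → 6 ≤ s → s % 4 ≡ 2 → ∃ λ k → s ≡ 6 + k * 4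
s≡6+k*4 s 6≤s s%4≡2 with s / 4 | m≡m%n+[m/n]*n s 4
... | zero  | s≡ = ⊥-elim (6≰2 (subst (6 ≤_) (trans s≡ (cong (_+ 0) s%4≡2)) 6≤s))
  where
  6≰2 : ¬ (6 ≤ 2)
  6≰2 (s≤s (s≤s ()))
... | suc k | s≡ = k , trans s≡ (cong (_+ suc k * 4) s%4≡2)

m*2≡n*4⇒m≡n*2 : ∀ m n → m * 2 ≡ n * 4 → m ≡ n * 2
m*2≡n*4⇒m≡n*2 m n eq = ℕ.*-cancelʳ-≡ m (n * 2) 2 (trans eq (sym (ℕ.*-assoc n 2 2)))

-- Square tiles if L and Q are both even; otherwise 4 divides the even one of them.
tile-split : ∀ L Q X → L * Q ≡ X * 4 → ∃ λ t → ∃ λ C → ∃ λ R → L ≡ C * width t × Q ≡ R * height t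
tile-split L Q X eq with parity L | parity Q
... | even c | even r = square , c , r , refl , refl
... | even c | odd r  =
  let c′ , c≡c′*2 , _ = odd-factor r c X (m*2≡n*4⇒m≡n*2 (suc (r * 2) * c) X
                                            (trans (ℕ.*-assoc (suc (r * 2)) c 2) (trans (ℕ.*-comm (suc (r * 2)) (c * 2)) eq)))
  in horizontal , c′ , suc (r * 2) , trans (cong (_* 2) c≡c′*2) (ℕ.*-assoc c′ 2 2) , sym (ℕ.*-identityʳ _)
... | odd c  | even r =
  let r′ , r≡r′*2 , _ = odd-factor c r X (m*2≡n*4⇒m≡n*2 (suc (c * 2) * r) X (trans (ℕ.*-assoc (suc (c * 2)) r 2) eq))
  in vertical , suc (c * 2) , r′ , sym (ℕ.*-identityʳ _) , trans (cong (_* 2) r≡r′*2) (ℕ.*-assoc r′ 2 2)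
... | odd c  | odd r  = ⊥-elim (even≢odd (X * 2) (c * r * 2 + c + r) (trans (ℕ.*-assoc X 2 2) (trans (sym eq) (odd*odd c r))))

tile-count : ∀ t C R → C * width t * (R * height t) ≡ R * C * 4
tile-count t C R = trans (swap C (width t) R (height t)) (cong (R * C *_) (height*width≡4 t))
  where
  swap : ∀ C w R h → C * w * (R * h) ≡ R * C * (h * w)
  swap = ℕ-Solver.solve-∀

even-t-quotient : ∀ n k Q L → 2 * (n * 2) * (6 + k * 4) ≡ L * (Q * 2) → L * Q ≡ n * (3 + k * 2) * 4
even-t-quotient n k Q L eq = ℕ.*-cancelʳ-≡ (L * Q) _ 2 (trans (ℕ.*-assoc L Q 2) (trans (sym eq) (count n k)))
  where
  count : ∀ n k → 2 * (n * 2) * (6 + k * 4) ≡ n * (3 + k * 2) * 4 * 2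
  count = ℕ-Solver.solve-∀

odd-t-quotient : ∀ n k H L → 2 * (n * 2) * (6 + k * 4) ≡ L * suc (H * 2) →
  ∃ λ C → L ≡ C * 2 ^ 3 × suc (H * 2) * C ≡ n * (3 + k * 2)
odd-t-quotient n k H L eq = odd-factor-2^ 3 H L (n * (3 + k * 2)) (trans (ℕ.*-comm (suc (H * 2)) L) (trans (sym eq) (count n k)))
  where
  count : ∀ n k → 2 * (n * 2) * (6 + k * 4) ≡ n * (3 + k * 2) * 2 ^ 3
  count = ℕ-Solver.solve-∀

m*2/2≡m : ∀ m → m * 2 / 2 ≡ m
m*2/2≡m m = m*n/n≡m m 2

[1+m*2]/2≡m : ∀ m → suc (m * 2) / 2 ≡ m
[1+m*2]/2≡m m = trans (cong (_/ 2) (ℕ.+-comm 1 (m * 2))) ([m*n+o]/n≡m m (s≤s (s≤s z≤n)))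

2≤n*2⇒n≢0 : ∀ {n} → 2 ≤ n * 2 → n ≢ 0
2≤n*2⇒n≢0 {suc n} _ ()

layout-sequence : ∀ {p} n k nbr nbc g h pA pJ .{{_ : ℕ.NonZero nbr}} .{{_ : ℕ.NonZero nbc}} .{{_ : ℕ.NonZero g}}
  .{{_ : ℕ.NonZero h}} .{{_ : ℕ.NonZero pA}} .{{_ : ℕ.NonZero pJ}} (ρ : ℕ → ℕ) (shape : ℕ → Shape p) →
  (∀ b → Fits (shape b) (Layout.table nbr nbc g h pA pJ ρ b)) → nbr * nbc ≡ n → g * h ≡ 3 + k * 2 → pA * pJ ≡ 4 →
  BlockSequence n (6 + k * 4) (GridSupport (nbr * g * pA) (nbc * h * pJ) ρ)
layout-sequence n k nbr nbc g h pA pJ ρ shape fits refl g*h≡D pA*pJ≡4 =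
  BlockSequence-⇔ (λ x → subst (λ D → SupportOf (nbr * nbc) D table x ⇔ GridSupport (nbr * g * pA) (nbc * h * pJ) ρ x) g*h≡D
                             (Layout.support nbr nbc g h pA pJ ρ pA*pJ≡4 x))
                  (blocks-from-tables (nbr * nbc) k table shape fits)
  where
  table : ℕ → Table
  table = Layout.table nbr nbc g h pA pJ ρ

linearGrid-sequence : ∀ n k Q L → n ≢ 0 → L * Q ≡ n * (3 + k * 2) * 4 →
  BlockSequence n (6 + k * 4) (Target (Q * suc L) Q (suc L))
linearGrid-sequence n k Q L n≢0 LQ≡ with tile-split L Q (n * (3 + k * 2)) LQ≡
... | t , C , R , refl , refl =
  BlockSequence-⇔ (λ x → ⇔-trans (GridSupport-cong (cong (_* height t) (sym R≡nbr*g)) (cong (_* width t) (sym C≡nbc*h)))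
                                 (linearGrid-support (R * height t) (C * width t) x))
    (layout-sequence n k nbr nbc g h (height t) (width t) (_* suc (C * width t)) (λ _ → flat)
       (linear-fits nbr nbc g t (suc (C * width t)) (oddSize g h k g*h≡D))
       nbr*nbc≡n g*h≡D (height*width≡4 t))
  where
  R*C≡ : R * C ≡ n * (3 + k * 2)
  R*C≡ = ℕ.*-cancelʳ-≡ (R * C) (n * (3 + k * 2)) 4 (trans (sym (tile-count t C R)) LQ≡)
  open Factorization (factorization R C n (3 + k * 2) R*C≡ (λ ()) n≢0)

oddGrid-sequence : ∀ n k H C → n ≢ 0 → suc (H * 2) * C ≡ n * (3 + k * 2) →
  BlockSequence n (6 + k * 4) (Target (H * suc (C * 4 + C * 4) + C * 4) H (suc (C * 4 + C * 4)))
oddGrid-sequence n k H C n≢0 eq =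
  BlockSequence-⇔ (λ x → ⇔-trans (GridSupport-cong (trans (ℕ.*-identityʳ (nbr * g)) (sym R≡nbr*g))
                                                   (cong (_* 4) (sym C≡nbc*h)))
                                 (oddGrid-support H (C * 4) x))
    (layout-sequence n k nbr nbc g h 1 4 (oddRowStart (C * 4)) (oddShapes nbr nbc g hs (C * 4))
       (odd-fits nbr nbc g (C * 4) hs) nbr*nbc≡n g*h≡D refl)
  where
  open Factorization (factorization (suc (H * 2)) C n (3 + k * 2) eq (λ ()) n≢0)
  hs : OddSize h
  hs = oddSize g h k g*h≡D

even-t-sequence : ∀ n k Q L → n ≢ 0 → 2 * (n * 2) * (6 + k * 4) ≡ L * (Q * 2) →
  BlockSequence n (6 + k * 4) (Target (n * 2 * (6 + k * 4) + Q) Q (suc L))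
even-t-sequence n k Q L n≢0 eq = BlockSequence-⇔ (λ x → Target-cong N≡ refl) (linearGrid-sequence n k Q L n≢0 LQ≡)
  where
  LQ≡ : L * Q ≡ n * (3 + k * 2) * 4
  LQ≡ = even-t-quotient n k Q L eq
  N≡ : Q * suc L ≡ n * 2 * (6 + k * 4) + Q
  N≡ = trans (unfold Q L) (cong (_+ Q) (trans LQ≡ (count n k)))
    where
    unfold : ∀ Q L → Q * suc L ≡ L * Q + Q
    unfold = ℕ-Solver.solve-∀
    count : ∀ n k → n * (3 + k * 2) * 4 ≡ n * 2 * (6 + k * 4)
    count = ℕ-Solver.solve-∀

odd-t-sequence : ∀ n k H L → n ≢ 0 → 2 * (n * 2) * (6 + k * 4) ≡ L * suc (H * 2) →
  BlockSequence n (6 + k * 4) (Target (n * 2 * (6 + k * 4) + H) H (suc L))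
odd-t-sequence n k H L n≢0 eq with odd-t-quotient n k H L eq
... | C , refl , eq′ =
  BlockSequence-⇔ (λ x → Target-cong N≡ (cong suc (C*4+C*4≡C*2^3 C))) (oddGrid-sequence n k H C n≢0 eq′)
  where
  C*4+C*4≡C*2^3 : ∀ C → C * 4 + C * 4 ≡ C * 2 ^ 3
  C*4+C*4≡C*2^3 = ℕ-Solver.solve-∀
  N≡ : H * suc (C * 4 + C * 4) + C * 4 ≡ n * 2 * (6 + k * 4) + H
  N≡ = trans (rearrange H C) (cong (_+ H) (trans (cong (_* 4) eq′) (count n k)))
    where
    rearrange : ∀ H C → H * suc (C * 4 + C * 4) + C * 4 ≡ suc (H * 2) * C * 4 + H
    rearrange = ℕ-Solver.solve-∀
    count : ∀ n k → n * (3 + k * 2) * 4 ≡ n * 2 * (6 + k * 4)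
    count = ℕ-Solver.solve-∀

lemma5p1 : (m s t : ℕ) → 2 ∣ m → 2 ≤ m → 6 ≤ s → s % 4 ≡ 2 →
    (d : t ∣ 2 * m * s) →
    let ℓ = quotient d + 1 in
    Σ (Fin (m / 2) → Block s) λ 𝓑 →
      ConditionD 𝓑 ×
      (∀ (x : ℕ) → InSupp 𝓑 x ⇔
        ((1 ≤ x × x ≤ m * s + t / 2) ×
         ¬ (∃ λ (j : ℕ) → (1 ≤ j × j ≤ t / 2) × x ≡ j * ℓ)))
lemma5p1 m s t (divides n refl) 2≤m 6≤s s%4≡2 (divides L 2ms≡Lt) with s≡6+k*4 s 6≤s s%4≡2
... | k , refl with parity t
...   | even Q rewrite m*2/2≡m n | m*2/2≡m Q | ℕ.+-comm L 1 = even-t-sequence n k Q L (2≤n*2⇒n≢0 2≤m) 2ms≡Lt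
...   | odd H  rewrite m*2/2≡m n | [1+m*2]/2≡m H | ℕ.+-comm L 1 = odd-t-sequence n k H L (2≤n*2⇒n≢0 2≤m) 2ms≡Lt
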